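{- Let $G$ be a 2-threshold graph and let $x$ be a vertex of $G$ with nonempty open neighborhood $N(x)$. Then the subgraph of $G$ induced by $N(x)$ is either (a) a threshold graph, or (b) the disjoint union of two threshold graphs, or (c) the join of two threshold graphs.
   Context: Graphs are finite and simple; $N(x)$ denotes the set of neighbors of $x$. A threshold graph is a graph in which every induced subgraph has an isolated vertex or a universal vertex. The union of graphs $G_1=(V_1,E_1)$, $G_2=(V_2,E_2)$ on disjoint vertex sets is $(V_1\cup V_2,E_1\cup E_2)$; their join is obtained from the union by adding all edges between $V_1$ and $V_2$. A graph $G=(V,E)$ is 2-threshold if there is a coloring of $V$ with two colors (black, white; any map) such that every nonempty $W\subseteq V$ contains a vertex $x$ that is isolated in $G[W]$ or adjacent in $G[W]$ to exactly the vertices of $W\setminus\{x\}$ of one fixed color. -}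

module Defs where

open import Data.Nat using (ℕ)
open import Data.Bool using (Bool; true; false)
open import Data.Fin using (Fin)
open import Data.Fin.Subset using (Subset; _∈_; _⊆_; Nonempty)
open import Data.Vec using (tabulate)
open import Data.Product using (Σ; ∃; _×_; _,_)
open import Data.Sum using (_⊎_)
open import Relation.Nullary using (¬_)
open import Data.Empty using (⊥)
open import Relation.Binary.PropositionalEquality using (_≡_; _≢_)
open import Function.Bundles using (_⇔_)

record Graph (n : ℕ) : Set where
  field
    adj    : Fin n → Fin n → Bool
    sym    : ∀ x y → adj x y ≡ adj y x
    irrefl : ∀ x → adj x x ≡ false

open Graph public

module _ {n : ℕ} (G : Graph n) where

  Edge : Fin n → Fin n → Set
  Edge x y = adj G x y ≡ true

  N : Fin n → Subset n
  N x = tabulate (λ y → adj G x y)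

  IsolatedIn : Subset n → Fin n → Set
  IsolatedIn W x = ∀ y → y ∈ W → ¬ Edge x y

  UniversalIn : Subset n → Fin n → Set
  UniversalIn W x = ∀ y → y ∈ W → y ≢ x → Edge x y

  ThresholdOn : Subset n → Set
  ThresholdOn S = ∀ W → W ⊆ S → Nonempty W →
    ∃ λ x → x ∈ W × (IsolatedIn W x ⊎ UniversalIn W x)

  TwoThreshold : Set
  TwoThreshold = Σ (Fin n → Bool) λ c → ∀ (W : Subset n) → Nonempty W →
    ∃ λ x → x ∈ W × (IsolatedIn W x ⊎
      ∃ λ (b : Bool) → ∀ y → y ∈ W → y ≢ x → (Edge x y ⇔ (c y ≡ b)))

  UnionOfTwoThreshold : Subset n → Set
  UnionOfTwoThreshold S = Σ (Subset n) λ S₁ → Σ (Subset n) λ S₂ →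
    S₁ ⊆ S × S₂ ⊆ S × (∀ y → y ∈ S → y ∈ S₁ ⊎ y ∈ S₂) ×
    (∀ y → y ∈ S₁ → y ∈ S₂ → ⊥) ×
    ThresholdOn S₁ × ThresholdOn S₂ ×
    (∀ u v → u ∈ S₁ → v ∈ S₂ → ¬ Edge u v)

  JoinOfTwoThreshold : Subset n → Set
  JoinOfTwoThreshold S = Σ (Subset n) λ S₁ → Σ (Subset n) λ S₂ →
    S₁ ⊆ S × S₂ ⊆ S × (∀ y → y ∈ S → y ∈ S₁ ⊎ y ∈ S₂) ×
    (∀ y → y ∈ S₁ → y ∈ S₂ → ⊥) ×
    ThresholdOn S₁ × ThresholdOn S₂ ×
    (∀ u v → u ∈ S₁ → v ∈ S₂ → Edge u v)

-- Let c be a 2-threshold colouring of G and x a vertex.  Split N(x) into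
-- A (neighbours of x coloured c x) and B (the other neighbours).  The engine
-- of the proof is the splitting-vertex lemma: every W ⊆ N(x) meeting both A
-- and B has a vertex whose neighbours in W are exactly the A-vertices of W
-- (apply 2-thresholdness to W ∪ {x}).  Applied to sets of three or four
-- vertices it yields the local facts we need; applied to all of W it feeds
-- the split criterion: a graph split into a clique K and an independent set I,
-- in which every set meeting both sides has a vertex seeing exactly its
-- K-part, is threshold (by well-founded induction along ⊂).
--
-- The theorem then follows by cases.  If B is independent, G[N(x)] is the
-- join of the A-vertices having a non-neighbour in A (monochromatic, hence
-- threshold) with the rest (a split graph as above).  If B contains an edge,
-- A is a clique and G[N(x)] is the disjoint union of the B-vertices having a
-- neighbour in B with the rest.
module Submission where

open import Defs
open import Data.Nat using (ℕ)
open import Data.Bool using (Bool; true; not) renaming (_≟_ to _≟ᵇ_)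
open import Data.Bool.Properties using (T-≡; ¬-not)
open import Data.Fin using (Fin) renaming (_≟_ to _≟ᶠ_)
open import Data.Fin.Subset using (Subset; _∈_; _∉_; _⊆_; _⊂_; Nonempty; _∪_; ⁅_⁆; _-_; _─_; inside; outside)
open import Data.Fin.Subset.Properties using (_∈?_; nonempty?; x∈⁅x⁆; x∈⁅y⁆⇒x≡y; x∈p∪q⁺; x∈p∪q⁻; p─q⊆p; x∈p∧x∉q⇒x∈p─q; x∈p∧x≢y⇒x∈p-y; x∈p⇒p-x⊂p)
open import Data.Fin.Subset.Induction using (⊂-wellFounded; Acc; acc)
open import Data.Fin.Properties using (any?)
open import Data.List using (List; []; _∷_)
open import Data.List.Relation.Unary.All using (All; []; _∷_) renaming (lookup to lookupAll)
open import Data.List.Relation.Unary.Any using (here; there) renaming (any? to anyₗ?)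
open import Data.List.Membership.Propositional using () renaming (_∈_ to _∈ₗ_)
open import Data.Vec using (tabulate)
import Data.Vec as Vec
open import Data.Vec.Properties using (lookup∘tabulate; []=⇒lookup; lookup⇒[]=)
open import Data.Product using (∃; _×_; _,_; proj₁; proj₂)
open import Data.Sum using (_⊎_; inj₁; inj₂; [_,_])
open import Data.Empty using (⊥-elim)
open import Relation.Nullary using (¬_; Dec; yes; no)
open import Relation.Nullary.Decidable using (isYes; toWitness; fromWitness; _×-dec_; ¬?)
open import Relation.Unary using (Decidable)
open import Relation.Binary.PropositionalEquality using (_≡_; _≢_; refl; trans; ≢-sym) renaming (sym to ≡-sym)
open import Function.Bundles using (_⇔_; mk⇔; Equivalence)
open import Function using (_∘_; id)

open Equivalence using (to; from)

private
  variable
    n : ℕ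

∈-tabulate⇔ : (f : Fin n → Bool) {y : Fin n} → y ∈ tabulate f ⇔ f y ≡ true
∈-tabulate⇔ f {y} = mk⇔
  (λ y∈ → trans (≡-sym (lookup∘tabulate f y)) ([]=⇒lookup y∈))
  (λ fy → lookup⇒[]= y (tabulate f) (trans (lookup∘tabulate f y) fy))

subset : {P : Fin n → Set} → Decidable P → Subset n
subset P? = tabulate (λ y → isYes (P? y))

∈-subset⁺ : {P : Fin n → Set} (P? : Decidable P) {y : Fin n} → P y → y ∈ subset P?
∈-subset⁺ P? {y} py = from (∈-tabulate⇔ _) (to T-≡ (fromWitness {a? = P? y} py))

∈-subset⁻ : {P : Fin n → Set} (P? : Decidable P) {y : Fin n} → y ∈ subset P? → P y
∈-subset⁻ P? {y} y∈ = toWitness {a? = P? y} (from T-≡ (to (∈-tabulate⇔ _) y∈))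

⟪_⟫ : List (Fin n) → Subset n
⟪ us ⟫ = subset (λ y → anyₗ? (y ≟ᶠ_) us)

∈⟪⟫⁺ : {us : List (Fin n)} {y : Fin n} → y ∈ₗ us → y ∈ ⟪ us ⟫
∈⟪⟫⁺ {us = us} = ∈-subset⁺ (λ y → anyₗ? (y ≟ᶠ_) us)

∈⟪⟫⁻ : {us : List (Fin n)} {y : Fin n} → y ∈ ⟪ us ⟫ → y ∈ₗ us
∈⟪⟫⁻ {us = us} = ∈-subset⁻ (λ y → anyₗ? (y ≟ᶠ_) us)

x∈p─q⇒x∉q : {x : Fin n} (p q : Subset n) → x ∈ p ─ q → x ∉ q
x∈p─q⇒x∉q (_ Vec.∷ p) (outside Vec.∷ q) (Vec.there x∈) (Vec.there x∈q) = x∈p─q⇒x∉q p q x∈ x∈q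
x∈p─q⇒x∉q (_ Vec.∷ p) (inside Vec.∷ q) (Vec.there x∈) (Vec.there x∈q) = x∈p─q⇒x∉q p q x∈ x∈q

∈-remove⁻ : {W : Subset n} {v y : Fin n} → y ∈ W - v → y ∈ W × y ≢ v
∈-remove⁻ {W = W} {v} y∈ =
  p─q⊆p W ⁅ v ⁆ y∈ , λ { refl → x∈p─q⇒x∉q W ⁅ v ⁆ y∈ (x∈⁅x⁆ v) }

another? : (W : Subset n) (w : Fin n) → Dec (∃ λ y → y ∈ W × y ≢ w)
another? W w = any? (λ y → (y ∈? W) ×-dec ¬? (y ≟ᶠ w))

∈-complement-split : (S T : Subset n) {y : Fin n} → y ∈ S → y ∈ T ⊎ y ∈ S ─ T
∈-complement-split S T {y} y∈S with y ∈? T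
... | yes y∈T = inj₁ y∈T
... | no  y∉T = inj₂ (x∈p∧x∉q⇒x∈p─q y∈S y∉T)

module _ (G : Graph n) where

  HasExtremeVertex : Subset n → Set
  HasExtremeVertex W = ∃ λ v → v ∈ W × (IsolatedIn G W v ⊎ UniversalIn G W v)

  SeesExactly : Subset n → (Fin n → Set) → Fin n → Set
  SeesExactly W P v = ∀ y → y ∈ W → y ≢ v → (Edge G v y ⇔ P y)

  IsolatedOrSeesOneColour : (Fin n → Bool) → Subset n → Fin n → Set
  IsolatedOrSeesOneColour c W v = IsolatedIn G W v ⊎ ∃ λ b → SeesExactly W (λ y → c y ≡ b) v

  IsTwoThresholdColouring : (Fin n → Bool) → Set
  IsTwoThresholdColouring c = ∀ W → Nonempty W → ∃ λ v → v ∈ W × IsolatedOrSeesOneColour c W v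

  union-with-complement : (S T : Subset n) → T ⊆ S → ThresholdOn G T → ThresholdOn G (S ─ T) →
    (∀ u v → u ∈ T → v ∈ S ─ T → ¬ Edge G u v) → UnionOfTwoThreshold G S
  union-with-complement S T T⊆S thrT thrR noEdges =
    T , S ─ T , T⊆S , p─q⊆p S T , (λ _ → ∈-complement-split S T) ,
    (λ _ y∈T y∈R → x∈p─q⇒x∉q S T y∈R y∈T) , thrT , thrR , noEdges

  join-with-complement : (S T : Subset n) → T ⊆ S → ThresholdOn G T → ThresholdOn G (S ─ T) →
    (∀ u v → u ∈ T → v ∈ S ─ T → Edge G u v) → JoinOfTwoThreshold G S
  join-with-complement S T T⊆S thrT thrR allEdges =
    T , S ─ T , T⊆S , p─q⊆p S T , (λ _ → ∈-complement-split S T) ,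
    (λ _ y∈T y∈R → x∈p─q⇒x∉q S T y∈R y∈T) , thrT , thrR , allEdges

  module _ (K I : Fin n → Set) where

    CoveredBy : Subset n → Set
    CoveredBy W = ∀ y → y ∈ W → K y ⊎ I y

    Splitting : Set
    Splitting = ∀ W → CoveredBy W → (∃ λ k → k ∈ W × K k) → (∃ λ i → i ∈ W × I i) →
      ∃ λ v → v ∈ W × SeesExactly W K v

module Adjacency (G : Graph n) where

  Edge? : (u v : Fin n) → Dec (Edge G u v)
  Edge? u v = adj G u v ≟ᵇ true

  edge-sym : {u v : Fin n} → Edge G u v → Edge G v u
  edge-sym {u} {v} e = trans (Graph.sym G v u) e

  edge⇒≢ : {u v : Fin n} → Edge G u v → u ≢ v
  edge⇒≢ {u} e refl with trans (≡-sym (irrefl G u)) e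
  ... | ()

  ∈N⇔ : {x y : Fin n} → y ∈ N G x ⇔ Edge G x y
  ∈N⇔ {x} = ∈-tabulate⇔ (adj G x)

module SplitCriterion (G : Graph n) (K I : Fin n → Set) (K? : Decidable K) (I? : Decidable I)
  (K-clique : ∀ u v → K u → K v → u ≢ v → Edge G u v)
  (I-independent : ∀ u v → I u → I v → ¬ Edge G u v)
  (splitting : Splitting G K I) where

  open Adjacency G

  -- If v sees exactly the K-part of W and w is isolated in G[W - v], then
  -- G[W] has an extreme vertex: w itself if w ≁ v; otherwise w ∈ K forces
  -- every other vertex into I, so any such vertex is isolated, and if there
  -- is none then W = {v, w} and v is universal.
  lift-isolated : ∀ {W v w} → CoveredBy G K I W → v ∈ W → SeesExactly G W K v →
    w ∈ W - v → IsolatedIn G (W - v) w → HasExtremeVertex G W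
  lift-isolated {W} {v} {w} cover v∈ sees w∈ iso with ∈-remove⁻ w∈ | Edge? w v
  ... | w∈W , _ | no w≁v = w , w∈W , inj₁ w-isolated
    where
    w-isolated : IsolatedIn G W w
    w-isolated y y∈ with y ≟ᶠ v
    ... | yes refl = w≁v
    ... | no  y≢v  = iso y (x∈p∧x≢y⇒x∈p-y y∈ y≢v)
  ... | w∈W , w≢v | yes w~v with another? (W - v) w
  ...   | no none = v , v∈ , inj₂ v-universal
    where
    v-universal : UniversalIn G W v
    v-universal y y∈ y≢v with y ≟ᶠ w
    ... | yes refl = edge-sym w~v
    ... | no  y≢w  = ⊥-elim (none (y , x∈p∧x≢y⇒x∈p-y y∈ y≢v , y≢w))
  ...   | yes (y , y∈ , y≢w) = y , proj₁ (∈-remove⁻ y∈) , inj₁ y-isolated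
    where
    w∈K : K w
    w∈K = to (sees w w∈W w≢v) (edge-sym w~v)
    not-in-K : ∀ z → z ∈ W - v → z ≢ w → ¬ K z
    not-in-K z z∈ z≢w z∈K = iso z z∈ (K-clique w z w∈K z∈K (≢-sym z≢w))
    in-I : ∀ z → z ∈ W - v → z ≢ w → I z
    in-I z z∈ z≢w = [ ⊥-elim ∘ not-in-K z z∈ z≢w , id ] (cover z (proj₁ (∈-remove⁻ z∈)))
    y-isolated : IsolatedIn G W y
    y-isolated z z∈ with z ≟ᶠ v | z ≟ᶠ w
    ... | yes refl | _ = λ y~v →
      not-in-K y y∈ y≢w (to (sees y (proj₁ (∈-remove⁻ y∈)) (proj₂ (∈-remove⁻ y∈))) (edge-sym y~v))
    ... | no  z≢v  | yes refl = λ y~w → iso y y∈ (edge-sym y~w)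
    ... | no  z≢v  | no  z≢w  =
      I-independent y z (in-I y y∈ y≢w) (in-I z (x∈p∧x≢y⇒x∈p-y z∈ z≢v) z≢w)

  -- Dually, if w is universal in G[W - v]: w itself is universal if w ~ v;
  -- otherwise w ∈ I forces every other vertex into K, so any such vertex is
  -- universal, and if there is none then W = {v, w} and v is isolated.
  lift-universal : ∀ {W v w} → CoveredBy G K I W → v ∈ W → SeesExactly G W K v →
    w ∈ W - v → UniversalIn G (W - v) w → HasExtremeVertex G W
  lift-universal {W} {v} {w} cover v∈ sees w∈ univ with ∈-remove⁻ w∈ | Edge? w v
  ... | w∈W , _ | yes w~v = w , w∈W , inj₂ w-universal
    where
    w-universal : UniversalIn G W w
    w-universal y y∈ y≢w with y ≟ᶠ v
    ... | yes refl = w~v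
    ... | no  y≢v  = univ y (x∈p∧x≢y⇒x∈p-y y∈ y≢v) y≢w
  ... | w∈W , w≢v | no w≁v with another? (W - v) w
  ...   | no none = v , v∈ , inj₁ v-isolated
    where
    v-isolated : IsolatedIn G W v
    v-isolated y y∈ with y ≟ᶠ v | y ≟ᶠ w
    ... | yes refl | _        = λ v~v → edge⇒≢ v~v refl
    ... | no  _    | yes refl = w≁v ∘ edge-sym
    ... | no  y≢v  | no  y≢w  = ⊥-elim (none (y , x∈p∧x≢y⇒x∈p-y y∈ y≢v , y≢w))
  ...   | yes (y , y∈ , y≢w) = y , proj₁ (∈-remove⁻ y∈) , inj₂ y-universal
    where
    w∈I : I w
    w∈I = [ (λ w∈K → ⊥-elim (w≁v (edge-sym (from (sees w w∈W w≢v) w∈K)))) , id ] (cover w w∈W)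
    in-K : ∀ z → z ∈ W - v → z ≢ w → K z
    in-K z z∈ z≢w = [ id , (λ z∈I → ⊥-elim (I-independent w z w∈I z∈I (univ z z∈ z≢w))) ]
      (cover z (proj₁ (∈-remove⁻ z∈)))
    y-universal : UniversalIn G W y
    y-universal z z∈ z≢y with z ≟ᶠ v | z ≟ᶠ w
    ... | yes refl | _        =
      edge-sym (from (sees y (proj₁ (∈-remove⁻ y∈)) (proj₂ (∈-remove⁻ y∈))) (in-K y y∈ y≢w))
    ... | no  _    | yes refl = edge-sym (univ y y∈ y≢w)
    ... | no  z≢v  | no  z≢w  =
      K-clique y z (in-K y y∈ y≢w) (in-K z (x∈p∧x≢y⇒x∈p-y z∈ z≢v) z≢w) (≢-sym z≢y)

  -- Induction along ⊂: a set inside K or inside I is a clique or independent;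
  -- otherwise remove a splitting vertex v, and lift the extreme vertex of W - v.
  has-extreme-vertex : ∀ W → CoveredBy G K I W → Nonempty W → HasExtremeVertex G W
  has-extreme-vertex W = go W (⊂-wellFounded W)
    where
    go : ∀ W → Acc _⊂_ W → CoveredBy G K I W → Nonempty W → HasExtremeVertex G W
    go W (acc smaller) cover (w , w∈)
      with any? (λ y → (y ∈? W) ×-dec K? y) | any? (λ y → (y ∈? W) ×-dec I? y)
    ... | _ | no noI = w , w∈ , inj₂ λ y y∈ y≢w → K-clique w y (in-K w∈) (in-K y∈) (≢-sym y≢w)
      where
      in-K : ∀ {y} → y ∈ W → K y
      in-K {y} y∈ = [ id , (λ y∈I → ⊥-elim (noI (y , y∈ , y∈I))) ] (cover y y∈)
    ... | no noK | yes _ = w , w∈ , inj₁ λ y y∈ → I-independent w y (in-I w∈) (in-I y∈)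
      where
      in-I : ∀ {y} → y ∈ W → I y
      in-I {y} y∈ = [ (λ y∈K → ⊥-elim (noK (y , y∈ , y∈K))) , id ] (cover y y∈)
    ... | yes hasK | yes hasI with splitting W cover hasK hasI
    ...   | v , v∈ , sees with nonempty? (W - v)
    ...     | no empty = v , v∈ , inj₂ λ y y∈ y≢v → ⊥-elim (empty (y , x∈p∧x≢y⇒x∈p-y y∈ y≢v))
    ...     | yes nonempty
      with go (W - v) (smaller (x∈p⇒p-x⊂p v∈)) (λ y → cover y ∘ proj₁ ∘ ∈-remove⁻) nonempty
    ...       | u , u∈ , inj₁ u-isolated  = lift-isolated  cover v∈ sees u∈ u-isolated
    ...       | u , u∈ , inj₂ u-universal = lift-universal cover v∈ sees u∈ u-universal

  threshold : ∀ S → CoveredBy G K I S → ThresholdOn G S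
  threshold S cover W W⊆S = has-extreme-vertex W (λ y → cover y ∘ W⊆S)

module TwoThresholdFacts (G : Graph n) (c : Fin n → Bool) (two-threshold : IsTwoThresholdColouring G c) where

  open Adjacency G

  -- A set all of one colour d is threshold: the vertex provided by c is
  -- isolated, or sees exactly colour d (so is universal), or sees exactly
  -- the other colour (so is isolated).
  monochromatic-threshold : ∀ d S → (∀ y → y ∈ S → c y ≡ d) → ThresholdOn G S
  monochromatic-threshold d S colour W W⊆S nonempty with two-threshold W nonempty
  ... | v , v∈ , inj₁ v-isolated = v , v∈ , inj₁ v-isolated
  ... | v , v∈ , inj₂ (b , sees) with b ≟ᵇ d
  ...   | yes refl = v , v∈ , inj₂ λ y y∈ y≢v → from (sees y y∈ y≢v) (colour y (W⊆S y∈))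
  ...   | no  b≢d  = v , v∈ , inj₁ λ y y∈ v~y →
    b≢d (trans (≡-sym (to (sees y y∈ (≢-sym (edge⇒≢ v~y))) v~y)) (colour y (W⊆S y∈)))

  module Neighbourhood (x : Fin n) where

    A B : Fin n → Set
    A y = Edge G x y × c y ≡ c x
    B y = Edge G x y × c y ≢ c x

    A? : Decidable A
    A? y = Edge? x y ×-dec (c y ≟ᵇ c x)

    B? : Decidable B
    B? y = Edge? x y ×-dec ¬? (c y ≟ᵇ c x)

    x-not-chosen : ∀ W → (∀ {y} → y ∈ W → Edge G x y) → ∀ {p q} → p ∈ W → q ∈ W →
      c p ≡ c x → c q ≢ c x → ¬ IsolatedOrSeesOneColour G c (W ∪ ⁅ x ⁆) x
    x-not-chosen W W⊆N p∈ q∈ cp cq (inj₁ x-isolated) = x-isolated _ (x∈p∪q⁺ (inj₁ p∈)) (W⊆N p∈)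
    x-not-chosen W W⊆N p∈ q∈ cp cq (inj₂ (b , sees)) =
      cq (trans (colour-b q∈) (trans (≡-sym (colour-b p∈)) cp))
      where
      colour-b : ∀ {y} → y ∈ W → c y ≡ b
      colour-b y∈ = to (sees _ (x∈p∪q⁺ (inj₁ y∈)) (≢-sym (edge⇒≢ (W⊆N y∈)))) (W⊆N y∈)

    -- A neighbour v of x chosen in W ∪ {x} is not isolated, so it sees exactly
    -- one colour, which must be c x; restricted to W it still does.
    neighbour-sees-colour-of-x : ∀ W {v} → Edge G x v →
      IsolatedOrSeesOneColour G c (W ∪ ⁅ x ⁆) v → SeesExactly G W (λ y → c y ≡ c x) v
    neighbour-sees-colour-of-x W x~v (inj₁ v-isolated) =
      ⊥-elim (v-isolated x (x∈p∪q⁺ (inj₂ (x∈⁅x⁆ x))) (edge-sym x~v))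
    neighbour-sees-colour-of-x W x~v (inj₂ (b , sees))
      with to (sees x (x∈p∪q⁺ (inj₂ (x∈⁅x⁆ x))) (edge⇒≢ x~v)) (edge-sym x~v)
    ... | refl = λ y y∈ → sees y (x∈p∪q⁺ (inj₁ y∈))

    -- The splitting-vertex lemma: a set W ⊆ N(x) meeting both colours has a
    -- vertex adjacent, within W, to exactly the vertices of colour c x
    -- (apply c to W ∪ {x} and use the two facts above).
    splitting-vertex : ∀ W → (∀ {y} → y ∈ W → Edge G x y) → ∀ {p q} → p ∈ W → q ∈ W →
      c p ≡ c x → c q ≢ c x → ∃ λ v → v ∈ W × SeesExactly G W (λ y → c y ≡ c x) v
    splitting-vertex W W⊆N p∈ q∈ cp cq with two-threshold (W ∪ ⁅ x ⁆) (x , x∈p∪q⁺ (inj₂ (x∈⁅x⁆ x)))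
    ... | v , v∈ , choice with x∈p∪q⁻ W ⁅ x ⁆ v∈
    ...   | inj₁ v∈W = v , v∈W , neighbour-sees-colour-of-x W (W⊆N v∈W) choice
    ...   | inj₂ v∈⁅x⁆ with x∈⁅y⁆⇒x≡y x v∈⁅x⁆
    ...     | refl = ⊥-elim (x-not-chosen W W⊆N p∈ q∈ cp cq choice)

    splitting-vertex-list : ∀ us → All (Edge G x) us → ∀ {p q} → p ∈ₗ us → q ∈ₗ us →
      c p ≡ c x → c q ≢ c x →
      ∃ λ v → v ∈ₗ us × ∀ y → y ∈ₗ us → y ≢ v → (Edge G v y ⇔ c y ≡ c x)
    splitting-vertex-list us x~us p∈ q∈ cp cq
      with splitting-vertex ⟪ us ⟫ (lookupAll x~us ∘ ∈⟪⟫⁻) (∈⟪⟫⁺ p∈) (∈⟪⟫⁺ q∈) cp cq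
    ... | v , v∈ , sees = v , ∈⟪⟫⁻ v∈ , λ y → sees y ∘ ∈⟪⟫⁺

    A≢B : ∀ {a b} → A a → B b → a ≢ b
    A≢B (_ , ca) (_ , cb) refl = cb ca

    -- Two non-adjacent A-vertices r, a make r adjacent to every B-vertex b:
    -- in {r, a, b} only b can be the splitting vertex.
    A-non-edge⇒B-adjacent : ∀ {r a b} → A r → A a → r ≢ a → ¬ Edge G r a → B b → Edge G r b
    A-non-edge⇒B-adjacent {r} {a} {b} r∈A@(x~r , cr) (x~a , ca) r≢a r≁a b∈B@(x~b , cb)
      with splitting-vertex-list (r ∷ a ∷ b ∷ []) (x~r ∷ x~a ∷ x~b ∷ []) (here refl) (there (there (here refl))) cr cb
    ... | _ , here refl , sees = ⊥-elim (r≁a (from (sees a (there (here refl)) (≢-sym r≢a)) ca))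
    ... | _ , there (here refl) , sees = ⊥-elim (r≁a (edge-sym (from (sees r (here refl) r≢a) cr)))
    ... | _ , there (there (here refl)) , sees = edge-sym (from (sees r (here refl) (A≢B r∈A b∈B)) cr)

    -- An edge r b' inside B keeps r away from every A-vertex a: no vertex of
    -- {r, b', a} could be the splitting vertex.
    B-edge⇒A-non-adjacent : ∀ {r b' a} → B r → B b' → Edge G r b' → A a → ¬ Edge G r a
    B-edge⇒A-non-adjacent {r} {b'} {a} (x~r , cr) (x~b' , cb') r~b' a∈A@(x~a , ca) r~a
      with splitting-vertex-list (r ∷ b' ∷ a ∷ []) (x~r ∷ x~b' ∷ x~a ∷ []) (there (there (here refl))) (here refl) ca cr
    ... | _ , here refl , sees = cb' (to (sees b' (there (here refl)) (≢-sym (edge⇒≢ r~b'))) r~b')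
    ... | _ , there (here refl) , sees = cr (to (sees r (here refl) (edge⇒≢ r~b')) (edge-sym r~b'))
    ... | _ , there (there (here refl)) , sees = cr (to (sees r (here refl) (edge⇒≢ r~a)) (edge-sym r~a))

    -- An edge inside B makes A a clique: in {a₁, a₂, b₁, b₂} the splitting
    -- vertex must be a₁ or a₂.
    B-edge⇒A-clique : ∀ {b₁ b₂ a₁ a₂} → B b₁ → B b₂ → Edge G b₁ b₂ → A a₁ → A a₂ → a₁ ≢ a₂ → Edge G a₁ a₂
    B-edge⇒A-clique {b₁} {b₂} {a₁} {a₂} (x~b₁ , cb₁) (x~b₂ , cb₂) b₁~b₂ (x~a₁ , ca₁) (x~a₂ , ca₂) a₁≢a₂
      with splitting-vertex-list (a₁ ∷ a₂ ∷ b₁ ∷ b₂ ∷ []) (x~a₁ ∷ x~a₂ ∷ x~b₁ ∷ x~b₂ ∷ [])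
             (here refl) (there (there (here refl))) ca₁ cb₁
    ... | _ , here refl , sees = from (sees a₂ (there (here refl)) (≢-sym a₁≢a₂)) ca₂
    ... | _ , there (here refl) , sees = edge-sym (from (sees a₁ (here refl) a₁≢a₂) ca₁)
    ... | _ , there (there (here refl)) , sees =
      ⊥-elim (cb₂ (to (sees b₂ (there (there (there (here refl)))) (≢-sym (edge⇒≢ b₁~b₂))) b₁~b₂))
    ... | _ , there (there (there (here refl))) , sees =
      ⊥-elim (cb₁ (to (sees b₁ (there (there (here refl))) (edge⇒≢ b₁~b₂)) (edge-sym b₁~b₂)))

    -- For K ⊆ A and I ⊆ B, seeing colour c x inside K ∪ I means seeing K, so
    -- the splitting-vertex lemma makes (K, I) splitting.
    splitting-for : (K I : Fin n → Set) → (∀ {y} → K y → A y) → (∀ {y} → I y → B y) → Splitting G K I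
    splitting-for K I K⊆A I⊆B W cover (k , k∈ , k∈K) (i , i∈ , i∈I)
      with splitting-vertex W (λ {y} y∈ → [ proj₁ ∘ K⊆A , proj₁ ∘ I⊆B ] (cover y y∈))
             k∈ i∈ (proj₂ (K⊆A k∈K)) (proj₂ (I⊆B i∈I))
    ... | v , v∈ , sees = v , v∈ , λ y y∈ y≢v → mk⇔
      (λ v~y → [ id , (λ y∈I → ⊥-elim (proj₂ (I⊆B y∈I) (to (sees y y∈ y≢v) v~y))) ] (cover y y∈))
      (from (sees y y∈ y≢v) ∘ proj₂ ∘ K⊆A)

    S : Subset n
    S = N G x

    -- If B is independent, G[S] is the join of T, the A-vertices having a
    -- non-neighbour in A, with the rest S ─ T.
    module IndependentB (B-independent : ∀ u v → B u → B v → ¬ Edge G u v) where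

      HasNonNeighbourInA : Fin n → Set
      HasNonNeighbourInA y = ∃ λ z → A z × z ≢ y × ¬ Edge G y z

      HasNonNeighbourInA? : Decidable HasNonNeighbourInA
      HasNonNeighbourInA? y = any? (λ z → A? z ×-dec ¬? (z ≟ᶠ y) ×-dec ¬? (Edge? y z))

      -- The A-part of S ─ T: A-vertices adjacent to all other A-vertices.
      K : Fin n → Set
      K y = A y × ¬ HasNonNeighbourInA y

      K? : Decidable K
      K? y = A? y ×-dec ¬? (HasNonNeighbourInA? y)

      T : Subset n
      T = subset (λ y → A? y ×-dec HasNonNeighbourInA? y)

      adjacent-within-A : ∀ {y} → ¬ HasNonNeighbourInA y → ∀ z → A z → z ≢ y → Edge G y z
      adjacent-within-A {y} ¬has z z∈A z≢y with Edge? y z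
      ... | yes y~z = y~z
      ... | no  y≁z = ⊥-elim (¬has (z , z∈A , z≢y , y≁z))

      rest-covered : CoveredBy G K B (S ─ T)
      rest-covered y y∈ with to ∈N⇔ (p─q⊆p S T y∈) | c y ≟ᵇ c x
      ... | x~y | yes cy = inj₁ ((x~y , cy) , λ has → x∈p─q⇒x∉q S T y∈ (∈-subset⁺ _ ((x~y , cy) , has)))
      ... | x~y | no  cy = inj₂ (x~y , cy)

      T-threshold : ThresholdOn G T
      T-threshold = monochromatic-threshold (c x) T λ _ y∈ → proj₂ (proj₁ (∈-subset⁻ _ y∈))

      rest-threshold : ThresholdOn G (S ─ T)
      rest-threshold = SplitCriterion.threshold G K B K? B?
        (λ u v (_ , ¬has) (v∈A , _) u≢v → adjacent-within-A ¬has v v∈A (≢-sym u≢v))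
        B-independent (splitting-for K B proj₁ id) (S ─ T) rest-covered

      T-rest-adjacent : ∀ u v → u ∈ T → v ∈ S ─ T → Edge G u v
      T-rest-adjacent u v u∈ v∈ with ∈-subset⁻ _ u∈ | rest-covered v v∈
      ... | u∈A , (z , z∈A , z≢u , u≁z) | inj₂ v∈B = A-non-edge⇒B-adjacent u∈A z∈A (≢-sym z≢u) u≁z v∈B
      ... | u∈A , has | inj₁ (_ , ¬has) = edge-sym (adjacent-within-A ¬has u u∈A u≢v)
        where
        u≢v : u ≢ v
        u≢v refl = ¬has has

      join : JoinOfTwoThreshold G S
      join = join-with-complement G S T (from ∈N⇔ ∘ proj₁ ∘ proj₁ ∘ ∈-subset⁻ _)
        T-threshold rest-threshold T-rest-adjacent

    -- If B contains an edge, A is a clique and G[S] is the disjoint union of T,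
    -- the B-vertices having a neighbour in B, with the rest S ─ T.
    module EdgeInB {b₁ b₂ : Fin n} (b₁∈B : B b₁) (b₂∈B : B b₂) (b₁~b₂ : Edge G b₁ b₂) where

      HasNeighbourInB : Fin n → Set
      HasNeighbourInB y = ∃ λ z → B z × Edge G y z

      HasNeighbourInB? : Decidable HasNeighbourInB
      HasNeighbourInB? y = any? (λ z → B? z ×-dec Edge? y z)

      -- The B-part of S ─ T: B-vertices without neighbours in B.
      I : Fin n → Set
      I y = B y × ¬ HasNeighbourInB y

      I? : Decidable I
      I? y = B? y ×-dec ¬? (HasNeighbourInB? y)

      T : Subset n
      T = subset (λ y → B? y ×-dec HasNeighbourInB? y)

      rest-covered : CoveredBy G A I (S ─ T)
      rest-covered y y∈ with to ∈N⇔ (p─q⊆p S T y∈) | c y ≟ᵇ c x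
      ... | x~y | yes cy = inj₁ (x~y , cy)
      ... | x~y | no  cy = inj₂ ((x~y , cy) , λ has → x∈p─q⇒x∉q S T y∈ (∈-subset⁺ _ ((x~y , cy) , has)))

      T-threshold : ThresholdOn G T
      T-threshold = monochromatic-threshold (not (c x)) T λ _ y∈ → ¬-not (proj₂ (proj₁ (∈-subset⁻ _ y∈)))

      rest-threshold : ThresholdOn G (S ─ T)
      rest-threshold = SplitCriterion.threshold G A I A? I?
        (λ _ _ → B-edge⇒A-clique b₁∈B b₂∈B b₁~b₂)
        (λ u v (_ , ¬has) (v∈B , _) u~v → ¬has (v , v∈B , u~v))
        (splitting-for A I id proj₁) (S ─ T) rest-covered

      T-rest-non-adjacent : ∀ u v → u ∈ T → v ∈ S ─ T → ¬ Edge G u v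
      T-rest-non-adjacent u v u∈ v∈ with ∈-subset⁻ _ u∈ | rest-covered v v∈
      ... | u∈B , (z , z∈B , u~z) | inj₁ v∈A = B-edge⇒A-non-adjacent u∈B z∈B u~z v∈A
      ... | u∈B , _ | inj₂ (_ , ¬has) = λ u~v → ¬has (u , u∈B , edge-sym u~v)

      union : UnionOfTwoThreshold G S
      union = union-with-complement G S T (from ∈N⇔ ∘ proj₁ ∘ proj₁ ∘ ∈-subset⁻ _)
        T-threshold rest-threshold T-rest-non-adjacent

    decomposition : UnionOfTwoThreshold G S ⊎ JoinOfTwoThreshold G S
    decomposition with any? (λ u → any? (λ v → B? u ×-dec B? v ×-dec Edge? u v))
    ... | yes (_ , _ , u∈B , v∈B , u~v) = inj₁ (EdgeInB.union u∈B v∈B u~v)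
    ... | no  no-edge = inj₂ (IndependentB.join λ u v u∈B v∈B u~v → no-edge (u , v , u∈B , v∈B , u~v))

lemma3 : ∀ {n : ℕ} (G : Graph n) → TwoThreshold G → (x : Fin n) →
    Nonempty (N G x) →
    ThresholdOn G (N G x) ⊎ UnionOfTwoThreshold G (N G x) ⊎ JoinOfTwoThreshold G (N G x)
lemma3 G (c , two-threshold) x _ = inj₂ (TwoThresholdFacts.Neighbourhood.decomposition G c two-threshold x)
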